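{- For every integer $n\ge1$ and every integer $k$ with $0\le k\le n-1$, let $a_{n,k}$ be the number of $e\in\mathbf{I}_n(021)$ with exactly $k$ ascents. Then $a_{n,k}=a_{n,n-k-1}$.
   Context: An inversion sequence of length $n$ is an integer sequence $e=(e_1,\ldots,e_n)$ with $0 \le e_i < i$ for all $i$; $\mathbf{I}_n(021)$ is the set of those with no $i<j<k$ such that $e_i<e_k<e_j$. An ascent of $e$ is an index $i$ with $e_i<e_{i+1}$. -}

module Defs where

open import Data.Nat using (ℕ; zero; suc; _<_; _<ᵇ_; _∸_; _+_; _≡ᵇ_)
open import Data.Bool using (Bool; true; false; _∧_; _∨_; not; if_then_else_)
open import Data.Bool.ListAction using (any)
open import Data.List using (List; []; _∷_; _++_; map; concatMap; length; filter; upTo)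
open import Relation.Binary.PropositionalEquality using (_≡_)
import Data.Bool

-- An inversion sequence e = (e_1,...,e_n) is represented as a list of
-- naturals [e_1, ..., e_n] (list position p, 0-based, holds e_{p+1}).

invSeqs : ℕ → List (List ℕ)
invSeqs zero    = [] ∷ []
invSeqs (suc n) = concatMap (λ e → map (λ x → e ++ (x ∷ [])) (upTo (suc n))) (invSeqs n)

-- Boolean: does the list contain indices i<j<k with e_i < e_k < e_j ?
-- containsPattern021 (x ∷ rest): either x plays the role of e_i (there exist
-- j<k in rest with x < rest_k < rest_j), or the pattern lies in rest.
-- has10Above x l : exist j<k in l with x < l_k < l_j
has10Above : ℕ → List ℕ → Bool
has10Above x []       = false
has10Above x (y ∷ ys) = any (λ z → (x <ᵇ z) ∧ (z <ᵇ y)) ys ∨ has10Above x ys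

contains021 : List ℕ → Bool
contains021 []       = false
contains021 (x ∷ xs) = has10Above x xs ∨ contains021 xs

avoids021 : List ℕ → Bool
avoids021 e = not (contains021 e)

ascentsFrom : ℕ → List ℕ → ℕ
ascentsFrom x []       = 0
ascentsFrom x (y ∷ ys) = (if x <ᵇ y then 1 else 0) + ascentsFrom y ys

ascents : List ℕ → ℕ
ascents []       = 0
ascents (x ∷ xs) = ascentsFrom x xs

a : ℕ → ℕ → ℕ
a n k = length (filter (λ e → (avoids021 e ∧ (ascents e ≡ᵇ k)) Data.Bool.≟ true) (invSeqs n))

private
  open import Relation.Binary.PropositionalEquality using (refl)
  t3 : a 3 0 ≡ 1
  t3 = refl

module Submission where

-- Every inversion sequence starts with e₁ = 0, and then avoiding 021 means
-- exactly that the positive entries weakly increase (avoids021-nondec).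
-- Reading the remaining entries from left to right, such a sequence is a
-- walk whose state records whether the previous entry was 0 or the current
-- maximum, and how many admissible values lie above the maximum; counting
-- these walks by ascents gives the transfer recursion `paths` (transfer).
-- Its bivariate generating functions H D s, with x marking ascents and y
-- the other adjacent pairs, satisfy a recursion in D with a unique
-- solution, which yields the first-return factorisation
-- H (D+1) s = H D s · (1 + x H 1 P).  For U = H 1 Z and V = H 1 P this gives
--   U = (1 + yU + xV)(1 + xV),   V = (1 + yU + yV)(1 + xV),
-- and every solution of this system has U(x, y) = V(y, x).  Hence the
-- generating function H 0 Z = 1 + yU + xV of I_{n+1}(021) by (ascents,
-- non-ascents) is symmetric in x and y, which is the theorem.

open import Algebra.Bundles using (CommutativeSemiring)
open import Algebra.Structures using (IsCommutativeSemiring)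
open import Data.Bool using (Bool; true; false; T; _∧_; _∨_; not; if_then_else_; _≟_)
open import Data.Bool.ListAction using (any)
open import Data.Bool.Properties using (∧-zeroʳ)
open import Data.List using (List; []; _∷_; [_]; _++_; map; concatMap; length; filter; upTo; applyUpTo)
open import Data.List.Properties
  using (map-concatMap; concatMap-map; concatMap-cong; concatMap-pure; map-∘; ++-identityʳ)
open import Data.List.Effectful using (module MonadProperties)
open import Data.Nat using (ℕ; zero; suc; _∸_; _≤_; _<_; z≤n; s≤s; _<ᵇ_; _≤ᵇ_; _≡ᵇ_; _≤?_)
open import Data.Product using (_×_; _,_; proj₁; proj₂)
open import Function using (_∘_)
open import Relation.Binary.Structures using (IsEquivalence)
open import Relation.Nullary using (yes; no)
open import Defs

-- They form again a
-- commutative semiring, which lets us iterate to bivariate series.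
module PowerSeries {c ℓ} (R : CommutativeSemiring c ℓ) where
  open CommutativeSemiring R
  open import Relation.Binary.Reasoning.Setoid setoid
  open import Algebra.Solver.Ring.NaturalCoefficients.Default R
  open import Algebra.Properties.CommutativeSemigroup +-commutativeSemigroup using (interchange)

  Series : Set c
  Series = ℕ → Carrier

  infix 4 _≋_
  infixl 6 _⊕_
  infixl 7 _⊛_

  _≋_ : Series → Series → Set ℓ
  f ≋ g = ∀ n → f n ≈ g n

  _⊕_ : Series → Series → Series
  (f ⊕ g) n = f n + g n

  _⊛_ : Series → Series → Series
  (f ⊛ g) zero    = f 0 * g 0
  (f ⊛ g) (suc n) = f 0 * g (suc n) + ((f ∘ suc) ⊛ g) n

  𝟘 : Series
  𝟘 _ = 0#

  𝟙 : Series
  𝟙 zero    = 1#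
  𝟙 (suc _) = 0#

  scale : Carrier → Series → Series
  scale r f n = r * f n

  ≋-isEquivalence : IsEquivalence _≋_
  ≋-isEquivalence = record
    { refl = λ n → refl ; sym = λ p n → sym (p n) ; trans = λ p q n → trans (p n) (q n) }

  ⊛-cong : ∀ {f f′ g g′} → f ≋ f′ → g ≋ g′ → f ⊛ g ≋ f′ ⊛ g′
  ⊛-cong p q zero    = *-cong (p 0) (q 0)
  ⊛-cong p q (suc n) = +-cong (*-cong (p 0) (q (suc n))) (⊛-cong (p ∘ suc) q n)

  ⊛-zeroˡ : ∀ g → 𝟘 ⊛ g ≋ 𝟘
  ⊛-zeroˡ g zero    = zeroˡ (g 0)
  ⊛-zeroˡ g (suc n) = trans (+-cong (zeroˡ _) (⊛-zeroˡ g n)) (+-identityˡ 0#)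

  ⊛-identityˡ : ∀ g → 𝟙 ⊛ g ≋ g
  ⊛-identityˡ g zero    = *-identityˡ _
  ⊛-identityˡ g (suc n) = trans (+-cong (*-identityˡ _) (⊛-zeroˡ g n)) (+-identityʳ _)

  ⊛-identityʳ : ∀ f → f ⊛ 𝟙 ≋ f
  ⊛-identityʳ f zero          = *-identityʳ _
  ⊛-identityʳ f (suc zero)    = trans (+-cong (zeroʳ _) (*-identityʳ _)) (+-identityˡ _)
  ⊛-identityʳ f (suc (suc n)) = trans (+-cong (zeroʳ _) (⊛-identityʳ (f ∘ suc) (suc n))) (+-identityˡ _)

  ⊛-distribʳ : ∀ f g h → (f ⊕ g) ⊛ h ≋ f ⊛ h ⊕ g ⊛ h
  ⊛-distribʳ f g h zero    = distribʳ _ _ _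
  ⊛-distribʳ f g h (suc n) =
    trans (+-cong (distribʳ _ _ _) (⊛-distribʳ (f ∘ suc) (g ∘ suc) h n)) (interchange _ _ _ _)

  -- the recursion may equally peel off the last term: the key to commutativity
  ⊛-unfoldʳ : ∀ f g n → (f ⊛ g) (suc n) ≈ (f ⊛ (g ∘ suc)) n + f (suc n) * g 0
  ⊛-unfoldʳ f g zero    = refl
  ⊛-unfoldʳ f g (suc n) = trans (+-congˡ (⊛-unfoldʳ (f ∘ suc) g n)) (sym (+-assoc _ _ _))

  ⊛-comm : ∀ f g → f ⊛ g ≋ g ⊛ f
  ⊛-comm f g zero    = *-comm _ _
  ⊛-comm f g (suc n) = begin
      f 0 * g (suc n) + ((f ∘ suc) ⊛ g) n
    ≈⟨ +-cong (*-comm _ _) (⊛-comm (f ∘ suc) g n) ⟩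
      g (suc n) * f 0 + (g ⊛ (f ∘ suc)) n
    ≈⟨ +-comm _ _ ⟩
      (g ⊛ (f ∘ suc)) n + g (suc n) * f 0
    ≈⟨ sym (⊛-unfoldʳ g f n) ⟩
      (g ⊛ f) (suc n) ∎

  scale-⊛ : ∀ r f g → scale r f ⊛ g ≋ scale r (f ⊛ g)
  scale-⊛ r f g zero    = *-assoc _ _ _
  scale-⊛ r f g (suc n) =
    trans (+-cong (*-assoc _ _ _) (scale-⊛ r (f ∘ suc) g n)) (sym (distribˡ _ _ _))

  ⊛-assoc : ∀ f g h → (f ⊛ g) ⊛ h ≋ f ⊛ (g ⊛ h)
  ⊛-assoc f g h zero    = *-assoc _ _ _
  ⊛-assoc f g h (suc n) = begin
      (f 0 * g 0) * h (suc n) + (((f ⊛ g) ∘ suc) ⊛ h) n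
    ≈⟨ +-congˡ (⊛-distribʳ (scale (f 0) (g ∘ suc)) ((f ∘ suc) ⊛ g) h n) ⟩
      (f 0 * g 0) * h (suc n) + ((scale (f 0) (g ∘ suc) ⊛ h) n + (((f ∘ suc) ⊛ g) ⊛ h) n)
    ≈⟨ +-congˡ (+-cong (scale-⊛ (f 0) (g ∘ suc) h n) (⊛-assoc (f ∘ suc) g h n)) ⟩
      (f 0 * g 0) * h (suc n) + (f 0 * ((g ∘ suc) ⊛ h) n + ((f ∘ suc) ⊛ (g ⊛ h)) n)
    ≈⟨ regroup _ _ _ _ _ ⟩
      f 0 * (g 0 * h (suc n) + ((g ∘ suc) ⊛ h) n) + ((f ∘ suc) ⊛ (g ⊛ h)) n ∎
    where
    regroup : ∀ a b c d e → (a * b) * c + (a * d + e) ≈ a * (b * c + d) + e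
    regroup = solve 5 (λ a b c d e → (a :* b) :* c :+ (a :* d :+ e) := a :* (b :* c :+ d) :+ e) refl

  seriesIsCommutativeSemiring : IsCommutativeSemiring _≋_ _⊕_ _⊛_ 𝟘 𝟙
  seriesIsCommutativeSemiring = record
    { isSemiring = record
      { isSemiringWithoutAnnihilatingZero = record
        { +-isCommutativeMonoid = record
          { isMonoid = record
            { isSemigroup = record
              { isMagma = record
                { isEquivalence = ≋-isEquivalence
                ; ∙-cong = λ p q n → +-cong (p n) (q n) }
              ; assoc = λ f g h n → +-assoc _ _ _ }
            ; identity = (λ f n → +-identityˡ _) , (λ f n → +-identityʳ _) }
          ; comm = λ f g n → +-comm _ _ }
        ; *-cong = ⊛-cong
        ; *-assoc = ⊛-assoc
        ; *-identity = ⊛-identityˡ , ⊛-identityʳ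
        ; distrib = (λ f g h n → trans (⊛-comm f (g ⊕ h) n)
                                   (trans (⊛-distribʳ g h f n) (+-cong (⊛-comm g f n) (⊛-comm h f n))))
                  , (λ h f g → ⊛-distribʳ f g h) }
      ; zero = ⊛-zeroˡ , (λ f n → trans (⊛-comm f 𝟘 n) (⊛-zeroˡ f n)) }
    ; *-comm = ⊛-comm }

  seriesSemiring : CommutativeSemiring c ℓ
  seriesSemiring = record { isCommutativeSemiring = seriesIsCommutativeSemiring }

-- ℕ arithmetic is opened only here, since PowerSeries opens the
-- operations of its semiring under the same names.
open import Data.Nat using (_+_; _*_)
open import Data.Nat.Properties
  using (+-*-commutativeSemiring; +-commutativeSemigroup; +-comm; +-assoc; +-identityʳ; +-suc;
         +-cancelʳ-≡; ≤-refl; ≤-reflexive; ≤-trans; ≤-pred; <⇒≤; ≤-<-trans; +-mono-≤; ≰⇒>; <ᵇ⇒<;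
         n<1+n; n≤1+n; m≤m+n; m∸n≤m; m+[n∸m]≡n; +-∸-assoc; m+n∸n≡m; m∸[m∸n]≡n)
open import Relation.Binary.PropositionalEquality
  using (_≡_; refl; sym; trans; cong; cong₂; subst; module ≡-Reasoning)

∑ : ℕ → (ℕ → ℕ) → ℕ
∑ zero    f = 0
∑ (suc n) f = f 0 + ∑ n (f ∘ suc)

∑-cong : ∀ n {f g : ℕ → ℕ} → (∀ i → i < n → f i ≡ g i) → ∑ n f ≡ ∑ n g
∑-cong zero    p = refl
∑-cong (suc n) p = cong₂ _+_ (p 0 (s≤s z≤n)) (∑-cong n (λ i i<n → p (suc i) (s≤s i<n)))

∑-zero : ∀ n {f : ℕ → ℕ} → (∀ i → f i ≡ 0) → ∑ n f ≡ 0
∑-zero zero    p = refl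
∑-zero (suc n) p = cong₂ _+_ (p 0) (∑-zero n (p ∘ suc))

∑-+ : ∀ n (f g : ℕ → ℕ) → ∑ n f + ∑ n g ≡ ∑ n (λ i → f i + g i)
∑-+ zero    f g = refl
∑-+ (suc n) f g = begin
    (f 0 + ∑ n (f ∘ suc)) + (g 0 + ∑ n (g ∘ suc))
  ≡⟨ interchange (f 0) (∑ n (f ∘ suc)) (g 0) (∑ n (g ∘ suc)) ⟩
    (f 0 + g 0) + (∑ n (f ∘ suc) + ∑ n (g ∘ suc))
  ≡⟨ cong (f 0 + g 0 +_) (∑-+ n (f ∘ suc) (g ∘ suc)) ⟩
    (f 0 + g 0) + ∑ n (λ i → f (suc i) + g (suc i)) ∎
  where
  open ≡-Reasoning
  open import Algebra.Properties.CommutativeSemigroup +-commutativeSemigroup using (interchange)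

∑-swap : ∀ n m (h : ℕ → ℕ → ℕ) → ∑ n (λ i → ∑ m (h i)) ≡ ∑ m (λ j → ∑ n (λ i → h i j))
∑-swap zero    m h = sym (∑-zero m (λ _ → refl))
∑-swap (suc n) m h =
  trans (cong (∑ m (h 0) +_) (∑-swap n m (h ∘ suc))) (∑-+ m (h 0) (λ j → ∑ n (λ i → h (suc i) j)))

∑-++ : ∀ m n (f : ℕ → ℕ) → ∑ (m + n) f ≡ ∑ m f + ∑ n (λ i → f (m + i))
∑-++ zero    n f = refl
∑-++ (suc m) n f = trans (cong (f 0 +_) (∑-++ m n (f ∘ suc))) (sym (+-assoc (f 0) _ _))

∑-last : ∀ n (f : ℕ → ℕ) → ∑ (suc n) f ≡ ∑ n f + f n
∑-last zero    f = +-comm (f 0) 0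
∑-last (suc n) f = trans (cong (f 0 +_) (∑-last n (f ∘ suc))) (sym (+-assoc (f 0) _ _))

-- Bivariate series over ℕ: F a b is the coefficient of xᵃ yᵇ.  They are
-- one-variable series (in x) whose coefficients are series in y.
module S₁ = PowerSeries +-*-commutativeSemiring
module S₂ = PowerSeries S₁.seriesSemiring
open S₂ using (_≋_; _⊕_; _⊛_; 𝟙)
module BiSeries = CommutativeSemiring S₂.seriesSemiring

Ser : Set
Ser = ℕ → ℕ → ℕ

-- coefficients of t · f for a one-variable series f; also the effect of
-- one more ascent on a table of counts indexed by the number of ascents
shift : (ℕ → ℕ) → ℕ → ℕ
shift f zero    = 0
shift f (suc k) = f k

X : Ser
X zero    = S₁.𝟘
X (suc a) = 𝟙 a

Y : Ser
Y zero    = shift S₁.𝟙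
Y (suc a) = S₁.𝟘

X-⊛ : ∀ F a b → (X ⊛ F) a b ≡ shift (λ i → F i b) a
X-⊛ F zero    b = S₁.⊛-zeroˡ (F 0) b
X-⊛ F (suc a) b = cong₂ _+_ (S₁.⊛-zeroˡ (F (suc a)) b) (S₂.⊛-identityˡ F a b)

Y-⊛ : ∀ F a b → (Y ⊛ F) a b ≡ shift (F a) b
Y-⊛ F a b = trans (Y-row a) (Y₀-⊛ (F a) b)
  where
  Y₀-⊛ : ∀ f b → (shift S₁.𝟙 S₁.⊛ f) b ≡ shift f b
  Y₀-⊛ f zero    = refl
  Y₀-⊛ f (suc b) = S₁.⊛-identityˡ f b
  Y-row : ∀ a → (Y ⊛ F) a b ≡ (shift S₁.𝟙 S₁.⊛ F a) b
  Y-row zero    = refl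
  Y-row (suc a) = trans (cong ((shift S₁.𝟙 S₁.⊛ F (suc a)) b +_) (S₂.⊛-zeroˡ F a b)) (+-identityʳ _)

S₁-⊛-coefficient : ∀ (f g : ℕ → ℕ) b → (f S₁.⊛ g) b ≡ ∑ (suc b) (λ j → f j * g (b ∸ j))
S₁-⊛-coefficient f g zero    = sym (+-identityʳ _)
S₁-⊛-coefficient f g (suc b) = cong (f 0 * g (suc b) +_) (S₁-⊛-coefficient (f ∘ suc) g b)

⊛-coefficient : ∀ (F G : Ser) a b →
  (F ⊛ G) a b ≡ ∑ (suc a) (λ i → ∑ (suc b) (λ j → F i j * G (a ∸ i) (b ∸ j)))
⊛-coefficient F G zero    b = trans (S₁-⊛-coefficient (F 0) (G 0) b) (sym (+-identityʳ _))
⊛-coefficient F G (suc a) b =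
  cong₂ _+_ (S₁-⊛-coefficient (F 0) (G (suc a)) b) (⊛-coefficient (F ∘ suc) G a b)

ι : Ser → Ser
ι F a b = F b a

ι-⊛ : ∀ F G → ι (F ⊛ G) ≋ ι F ⊛ ι G
ι-⊛ F G a b = begin
    (F ⊛ G) b a
  ≡⟨ ⊛-coefficient F G b a ⟩
    ∑ (suc b) (λ i → ∑ (suc a) (λ j → F i j * G (b ∸ i) (a ∸ j)))
  ≡⟨ ∑-swap (suc b) (suc a) (λ i j → F i j * G (b ∸ i) (a ∸ j)) ⟩
    ∑ (suc a) (λ j → ∑ (suc b) (λ i → F i j * G (b ∸ i) (a ∸ j)))
  ≡⟨ sym (⊛-coefficient (ι F) (ι G) a b) ⟩
    (ι F ⊛ ι G) a b ∎
  where open ≡-Reasoning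

ι-𝟙 : ι 𝟙 ≋ 𝟙
ι-𝟙 zero    zero    = refl
ι-𝟙 zero    (suc b) = refl
ι-𝟙 (suc a) zero    = refl
ι-𝟙 (suc a) (suc b) = refl

ι-X : ι X ≋ Y
ι-X zero    zero          = refl
ι-X zero    (suc zero)    = refl
ι-X zero    (suc (suc b)) = refl
ι-X (suc a) zero          = refl
ι-X (suc a) (suc zero)    = refl
ι-X (suc a) (suc (suc b)) = refl

ι-Y : ι Y ≋ X
ι-Y a b = sym (ι-X b a)

∑S : ℕ → (ℕ → Ser) → Ser
∑S zero    F = S₂.𝟘
∑S (suc n) F = F 0 ⊕ ∑S n (F ∘ suc)

∑S-coefficient : ∀ n (F : ℕ → Ser) a b → ∑S n F a b ≡ ∑ n (λ c → F c a b)
∑S-coefficient zero    F a b = refl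
∑S-coefficient (suc n) F a b = cong (F 0 a b +_) (∑S-coefficient n (F ∘ suc) a b)

∑S-last : ∀ n (F : ℕ → Ser) → ∑S (suc n) F ≋ ∑S n F ⊕ F n
∑S-last n F a b = begin
    ∑S (suc n) F a b
  ≡⟨ ∑S-coefficient (suc n) F a b ⟩
    ∑ (suc n) (λ c → F c a b)
  ≡⟨ ∑-last n (λ c → F c a b) ⟩
    ∑ n (λ c → F c a b) + F n a b
  ≡⟨ cong (_+ F n a b) (sym (∑S-coefficient n F a b)) ⟩
    ∑S n F a b + F n a b ∎
  where open ≡-Reasoning

∑S-cong : ∀ n {F G : ℕ → Ser} → (∀ c → c < n → F c ≋ G c) → ∑S n F ≋ ∑S n G
∑S-cong zero    p a b = refl
∑S-cong (suc n) p a b = cong₂ _+_ (p 0 (s≤s z≤n) a b) (∑S-cong n (λ c c<n → p (suc c) (s≤s c<n)) a b)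

∑S-⊛ : ∀ n (F : ℕ → Ser) G → ∑S n F ⊛ G ≋ ∑S n (λ c → F c ⊛ G)
∑S-⊛ zero    F G = S₂.⊛-zeroˡ G
∑S-⊛ (suc n) F G a b =
  trans (S₂.⊛-distribʳ (F 0) (∑S n (F ∘ suc)) G a b) (cong ((F 0 ⊛ G) a b +_) (∑S-⊛ n (F ∘ suc) G a b))

-- A recursion
-- in which every occurrence of the unknown is multiplied by x or y raises
-- the degree of agreement by one, so solutions are unique (agree-everywhere).
AgreeBelow : ℕ → Ser → Ser → Set
AgreeBelow n F G = ∀ a b → a + b < n → F a b ≡ G a b

agree-refl : ∀ {n F} → AgreeBelow n F F
agree-refl a b _ = refl

agree-zero : ∀ {F G} → AgreeBelow 0 F G
agree-zero a b ()

agree-≋ : ∀ {n F F′ G G′} → F ≋ F′ → G ≋ G′ → AgreeBelow n F′ G′ → AgreeBelow n F G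
agree-≋ p q r a b lt = trans (p a b) (trans (r a b lt) (sym (q a b)))

agree-everywhere : ∀ {F G} → (∀ n → AgreeBelow n F G) → F ≋ G
agree-everywhere p a b = p (suc (a + b)) a b ≤-refl

agree-⊕ : ∀ {n F F′ G G′} → AgreeBelow n F F′ → AgreeBelow n G G′ → AgreeBelow n (F ⊕ G) (F′ ⊕ G′)
agree-⊕ p q a b lt = cong₂ _+_ (p a b lt) (q a b lt)

-- a coefficient of a product only involves coefficients of lower or equal degree
agree-⊛ : ∀ {n F F′ G G′} → AgreeBelow n F F′ → AgreeBelow n G G′ → AgreeBelow n (F ⊛ G) (F′ ⊛ G′)
agree-⊛ {F = F} {F′} {G} {G′} p q a b lt = begin
    (F ⊛ G) a b
  ≡⟨ ⊛-coefficient F G a b ⟩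
    ∑ (suc a) (λ i → ∑ (suc b) (λ j → F i j * G (a ∸ i) (b ∸ j)))
  ≡⟨ ∑-cong (suc a) (λ i i≤a → ∑-cong (suc b) (λ j j≤b → cong₂ _*_
       (p i j (≤-<-trans (+-mono-≤ (≤-pred i≤a) (≤-pred j≤b)) lt))
       (q (a ∸ i) (b ∸ j) (≤-<-trans (+-mono-≤ (m∸n≤m a i) (m∸n≤m b j)) lt)))) ⟩
    ∑ (suc a) (λ i → ∑ (suc b) (λ j → F′ i j * G′ (a ∸ i) (b ∸ j)))
  ≡⟨ sym (⊛-coefficient F′ G′ a b) ⟩
    (F′ ⊛ G′) a b ∎
  where open ≡-Reasoning

agree-X : ∀ {n F F′} → AgreeBelow n F F′ → AgreeBelow (suc n) (X ⊛ F) (X ⊛ F′)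
agree-X {F = F} {F′} p zero    b lt       = trans (X-⊛ F 0 b) (sym (X-⊛ F′ 0 b))
agree-X {F = F} {F′} p (suc a) b (s≤s lt) = trans (X-⊛ F (suc a) b) (trans (p a b lt) (sym (X-⊛ F′ (suc a) b)))

agree-Y : ∀ {n F F′} → AgreeBelow n F F′ → AgreeBelow (suc n) (Y ⊛ F) (Y ⊛ F′)
agree-Y {F = F} {F′} p a zero    lt = trans (Y-⊛ F a 0) (sym (Y-⊛ F′ a 0))
agree-Y {n} {F} {F′} p a (suc b) lt =
  trans (Y-⊛ F a (suc b)) (trans (p a b (≤-pred (subst (_< suc n) (+-suc a b) lt))) (sym (Y-⊛ F′ a (suc b))))

agree-∑S : ∀ {n} m {F F′ : ℕ → Ser} → (∀ c → AgreeBelow n (F c) (F′ c)) → AgreeBelow n (∑S m F) (∑S m F′)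
agree-∑S zero    p = agree-refl
agree-∑S (suc m) p = agree-⊕ (p 0) (agree-∑S m (p ∘ suc))

-- The system U = (1 + yU + xV)(1 + xV), V = (1 + yU + yV)(1 + xV) has a
-- unique solution, and it satisfies U(x, y) = V(y, x): the system can be
-- rewritten in a dual form which, after exchanging x and y, is the
-- original system for the pair (ι V, ι U).
module SymmetricSystem where
  open import Algebra.Solver.Ring.NaturalCoefficients.Default S₂.seriesSemiring
  open import Relation.Binary.Reasoning.Setoid BiSeries.setoid

  System : Ser → Ser → Set
  System U V = (U ≋ (𝟙 ⊕ Y ⊛ U ⊕ X ⊛ V) ⊛ (𝟙 ⊕ X ⊛ V))
             × (V ≋ (𝟙 ⊕ Y ⊛ U ⊕ Y ⊛ V) ⊛ (𝟙 ⊕ X ⊛ V))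

  system-agree : ∀ {U V U′ V′} → System U V → System U′ V′ →
                 ∀ n → AgreeBelow n U U′ × AgreeBelow n V V′
  system-agree s s′ zero = agree-zero , agree-zero
  system-agree (sU , sV) (sU′ , sV′) (suc n) with system-agree (sU , sV) (sU′ , sV′) n
  ... | agreeU , agreeV =
      agree-≋ sU sU′ (agree-⊛ (agree-⊕ (agree-⊕ agree-refl (agree-Y agreeU)) (agree-X agreeV))
                              (agree-⊕ agree-refl (agree-X agreeV)))
    , agree-≋ sV sV′ (agree-⊛ (agree-⊕ (agree-⊕ agree-refl (agree-Y agreeU)) (agree-Y agreeV))
                              (agree-⊕ agree-refl (agree-X agreeV)))

  ⊕-cancelʳ : ∀ {A B C} → A ⊕ C ≋ B ⊕ C → A ≋ B
  ⊕-cancelʳ {A} {B} {C} p a b = +-cancelʳ-≡ (C a b) (A a b) (B a b) (p a b)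

  module Dual {U V} (sys : System U V) where
    private
      sU = proj₁ sys
      sV = proj₂ sys

    balance : U ⊕ Y ⊛ (U ⊛ U) ≋ V ⊕ X ⊛ (V ⊛ V)
    balance = ⊕-cancelʳ (begin
        U ⊕ Y ⊛ (U ⊛ U) ⊕ ((𝟙 ⊕ Y ⊛ V ⊕ Y ⊛ U) ⊛ U ⊕ (𝟙 ⊕ X ⊛ V ⊕ Y ⊛ U) ⊛ V)
      ≈⟨ BiSeries.+-congˡ {U ⊕ Y ⊛ (U ⊛ U)} (BiSeries.+-congʳ {(𝟙 ⊕ X ⊛ V ⊕ Y ⊛ U) ⊛ V}
           (BiSeries.*-congˡ {𝟙 ⊕ Y ⊛ V ⊕ Y ⊛ U} sU)) ⟩
        U ⊕ Y ⊛ (U ⊛ U) ⊕ ((𝟙 ⊕ Y ⊛ V ⊕ Y ⊛ U) ⊛ ((𝟙 ⊕ Y ⊛ U ⊕ X ⊛ V) ⊛ (𝟙 ⊕ X ⊛ V))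
                          ⊕ (𝟙 ⊕ X ⊛ V ⊕ Y ⊛ U) ⊛ V)
      ≈⟨ identity U V X Y ⟩
        V ⊕ X ⊛ (V ⊛ V) ⊕ ((𝟙 ⊕ Y ⊛ V ⊕ Y ⊛ U) ⊛ U
                          ⊕ (𝟙 ⊕ X ⊛ V ⊕ Y ⊛ U) ⊛ ((𝟙 ⊕ Y ⊛ U ⊕ Y ⊛ V) ⊛ (𝟙 ⊕ X ⊛ V)))
      ≈⟨ BiSeries.+-congˡ {V ⊕ X ⊛ (V ⊛ V)} (BiSeries.+-congˡ {(𝟙 ⊕ Y ⊛ V ⊕ Y ⊛ U) ⊛ U}
           (BiSeries.*-congˡ {𝟙 ⊕ X ⊛ V ⊕ Y ⊛ U} (BiSeries.sym sV))) ⟩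
        V ⊕ X ⊛ (V ⊛ V) ⊕ ((𝟙 ⊕ Y ⊛ V ⊕ Y ⊛ U) ⊛ U ⊕ (𝟙 ⊕ X ⊛ V ⊕ Y ⊛ U) ⊛ V) ∎)
      where
      identity : ∀ u v x y →
        u ⊕ y ⊛ (u ⊛ u) ⊕ ((𝟙 ⊕ y ⊛ v ⊕ y ⊛ u) ⊛ ((𝟙 ⊕ y ⊛ u ⊕ x ⊛ v) ⊛ (𝟙 ⊕ x ⊛ v)) ⊕ (𝟙 ⊕ x ⊛ v ⊕ y ⊛ u) ⊛ v)
        ≋ v ⊕ x ⊛ (v ⊛ v) ⊕ ((𝟙 ⊕ y ⊛ v ⊕ y ⊛ u) ⊛ u ⊕ (𝟙 ⊕ x ⊛ v ⊕ y ⊛ u) ⊛ ((𝟙 ⊕ y ⊛ u ⊕ y ⊛ v) ⊛ (𝟙 ⊕ x ⊛ v)))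
      identity = solve 4 (λ u v x y →
        u :+ y :* (u :* u) :+ ((con 1 :+ y :* v :+ y :* u) :* ((con 1 :+ y :* u :+ x :* v) :* (con 1 :+ x :* v)) :+ (con 1 :+ x :* v :+ y :* u) :* v)
        := v :+ x :* (v :* v) :+ ((con 1 :+ y :* v :+ y :* u) :* u :+ (con 1 :+ x :* v :+ y :* u) :* ((con 1 :+ y :* u :+ y :* v) :* (con 1 :+ x :* v))))
        BiSeries.refl

    -- the dual form of the system: each equation with the roles of the
    -- factors exchanged, obtained by cancelling the balanced terms
    V-dual : V ≋ (𝟙 ⊕ X ⊛ V ⊕ Y ⊛ U) ⊛ (𝟙 ⊕ Y ⊛ U)
    V-dual = BiSeries.trans sV (BiSeries.sym (⊕-cancelʳ (begin
        (𝟙 ⊕ X ⊛ V ⊕ Y ⊛ U) ⊛ (𝟙 ⊕ Y ⊛ U) ⊕ Y ⊛ (V ⊕ X ⊛ (V ⊛ V))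
      ≈⟨ identity U V X Y ⟩
        (𝟙 ⊕ Y ⊛ U ⊕ Y ⊛ V) ⊛ (𝟙 ⊕ X ⊛ V) ⊕ Y ⊛ (U ⊕ Y ⊛ (U ⊛ U))
      ≈⟨ BiSeries.+-congˡ {(𝟙 ⊕ Y ⊛ U ⊕ Y ⊛ V) ⊛ (𝟙 ⊕ X ⊛ V)} (BiSeries.*-congˡ {Y} balance) ⟩
        (𝟙 ⊕ Y ⊛ U ⊕ Y ⊛ V) ⊛ (𝟙 ⊕ X ⊛ V) ⊕ Y ⊛ (V ⊕ X ⊛ (V ⊛ V)) ∎)))
      where
      identity : ∀ u v x y →
        (𝟙 ⊕ x ⊛ v ⊕ y ⊛ u) ⊛ (𝟙 ⊕ y ⊛ u) ⊕ y ⊛ (v ⊕ x ⊛ (v ⊛ v))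
        ≋ (𝟙 ⊕ y ⊛ u ⊕ y ⊛ v) ⊛ (𝟙 ⊕ x ⊛ v) ⊕ y ⊛ (u ⊕ y ⊛ (u ⊛ u))
      identity = solve 4 (λ u v x y →
        (con 1 :+ x :* v :+ y :* u) :* (con 1 :+ y :* u) :+ y :* (v :+ x :* (v :* v))
        := (con 1 :+ y :* u :+ y :* v) :* (con 1 :+ x :* v) :+ y :* (u :+ y :* (u :* u)))
        BiSeries.refl

    U-dual : U ≋ (𝟙 ⊕ X ⊛ V ⊕ X ⊛ U) ⊛ (𝟙 ⊕ Y ⊛ U)
    U-dual = BiSeries.trans sU (BiSeries.sym (⊕-cancelʳ (begin
        (𝟙 ⊕ X ⊛ V ⊕ X ⊛ U) ⊛ (𝟙 ⊕ Y ⊛ U) ⊕ X ⊛ (V ⊕ X ⊛ (V ⊛ V))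
      ≈⟨ identity U V X Y ⟩
        (𝟙 ⊕ Y ⊛ U ⊕ X ⊛ V) ⊛ (𝟙 ⊕ X ⊛ V) ⊕ X ⊛ (U ⊕ Y ⊛ (U ⊛ U))
      ≈⟨ BiSeries.+-congˡ {(𝟙 ⊕ Y ⊛ U ⊕ X ⊛ V) ⊛ (𝟙 ⊕ X ⊛ V)} (BiSeries.*-congˡ {X} balance) ⟩
        (𝟙 ⊕ Y ⊛ U ⊕ X ⊛ V) ⊛ (𝟙 ⊕ X ⊛ V) ⊕ X ⊛ (V ⊕ X ⊛ (V ⊛ V)) ∎)))
      where
      identity : ∀ u v x y →
        (𝟙 ⊕ x ⊛ v ⊕ x ⊛ u) ⊛ (𝟙 ⊕ y ⊛ u) ⊕ x ⊛ (v ⊕ x ⊛ (v ⊛ v))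
        ≋ (𝟙 ⊕ y ⊛ u ⊕ x ⊛ v) ⊛ (𝟙 ⊕ x ⊛ v) ⊕ x ⊛ (u ⊕ y ⊛ (u ⊛ u))
      identity = solve 4 (λ u v x y →
        (con 1 :+ x :* v :+ x :* u) :* (con 1 :+ y :* u) :+ x :* (v :+ x :* (v :* v))
        := (con 1 :+ y :* u :+ x :* v) :* (con 1 :+ x :* v) :+ x :* (u :+ y :* (u :* u)))
        BiSeries.refl

  ι-cong : ∀ {F G} → F ≋ G → ι F ≋ ι G
  ι-cong p a b = p b a

  ι-⊕-cong : ∀ {F G F′ G′} → ι F ≋ F′ → ι G ≋ G′ → ι (F ⊕ G) ≋ F′ ⊕ G′
  ι-⊕-cong p q = BiSeries.+-cong p q

  ι-⊛-cong : ∀ {F G F′ G′} → ι F ≋ F′ → ι G ≋ G′ → ι (F ⊛ G) ≋ F′ ⊛ G′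
  ι-⊛-cong {F} {G} p q = BiSeries.trans (ι-⊛ F G) (BiSeries.*-cong p q)

  -- transposing the dual form gives the system for (ι V, ι U)
  transposed : ∀ {U V} → System U V → System (ι V) (ι U)
  transposed {U} {V} sys =
      BiSeries.trans (ι-cong V-dual)
        (ι-⊛-cong (ι-⊕-cong (ι-⊕-cong ι-𝟙 (ι-⊛-cong ι-X BiSeries.refl)) (ι-⊛-cong ι-Y BiSeries.refl))
                  (ι-⊕-cong ι-𝟙 (ι-⊛-cong ι-Y BiSeries.refl)))
    , BiSeries.trans (ι-cong U-dual)
        (ι-⊛-cong (ι-⊕-cong (ι-⊕-cong ι-𝟙 (ι-⊛-cong ι-X BiSeries.refl)) (ι-⊛-cong ι-X BiSeries.refl))
                  (ι-⊕-cong ι-𝟙 (ι-⊛-cong ι-Y BiSeries.refl)))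
    where open Dual sys

  symmetric : ∀ {U V} → System U V → U ≋ ι V
  symmetric sys = agree-everywhere (λ n → proj₁ (system-agree sys (transposed sys) n))

count : (List ℕ → Bool) → List (List ℕ) → ℕ
count p []      = 0
count p (e ∷ l) = (if p e then 1 else 0) + count p l

count-filter : ∀ p l → length (filter (λ e → p e ≟ true) l) ≡ count p l
count-filter p []      = refl
count-filter p (e ∷ l) with p e
... | true  = cong suc (count-filter p l)
... | false = count-filter p l

count-++ : ∀ p xs ys → count p (xs ++ ys) ≡ count p xs + count p ys
count-++ p []       ys = refl
count-++ p (e ∷ xs) ys =
  trans (cong (_ +_) (count-++ p xs ys)) (sym (+-assoc (if p e then 1 else 0) (count p xs) (count p ys)))

count-map : ∀ p (g : List ℕ → List ℕ) l → count p (map g l) ≡ count (p ∘ g) l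
count-map p g []      = refl
count-map p g (e ∷ l) = cong (_ +_) (count-map p g l)

count-cong : ∀ {p q} → (∀ e → p e ≡ q e) → ∀ l → count p l ≡ count q l
count-cong p≡q []      = refl
count-cong p≡q (e ∷ l) = cong₂ (λ b n → (if b then 1 else 0) + n) (p≡q e) (count-cong p≡q l)

count-none : ∀ {p} → (∀ e → p e ≡ false) → ∀ l → count p l ≡ 0
count-none none []      = refl
count-none none (e ∷ l) = cong₂ (λ b n → (if b then 1 else 0) + n) (none e) (count-none none l)

-- tails i L lists the sequences (x₁, …, x_L) with x_j ≤ i + j - 1, i.e. the
-- possible continuations of an inversion sequence after its i-th entry.
-- Built front to back, whereas invSeqs appends entries at the back.
tails : ℕ → ℕ → List (List ℕ)
tails i zero    = [] ∷ []
tails i (suc L) = concatMap (λ x → map (x ∷_) (tails (suc i) L)) (upTo (suc i))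

tails-snoc : ∀ L i →
  tails i (suc L) ≡ concatMap (λ f → map (λ x → f ++ (x ∷ [])) (upTo (suc (i + L)))) (tails i L)
tails-snoc zero i = begin
    concatMap (λ x → (x ∷ []) ∷ []) (upTo (suc i))
  ≡⟨ concatMap-map [_] [_] (upTo (suc i)) ⟨
    concatMap [_] (map [_] (upTo (suc i)))
  ≡⟨ concatMap-pure (map [_] (upTo (suc i))) ⟩
    map [_] (upTo (suc i))
  ≡⟨ cong (λ n → map [_] (upTo (suc n))) (+-identityʳ i) ⟨
    map [_] (upTo (suc (i + 0)))
  ≡⟨ ++-identityʳ _ ⟨
    map [_] (upTo (suc (i + 0))) ++ [] ∎
  where open ≡-Reasoning
tails-snoc (suc L) i = begin
    concatMap (λ x → map (x ∷_) (tails (suc i) (suc L))) (upTo (suc i))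
  ≡⟨ concatMap-cong (λ x → cong (map (x ∷_)) (tails-snoc L (suc i))) (upTo (suc i)) ⟩
    concatMap (λ x → map (x ∷_) (concatMap extend (tails (suc i) L))) (upTo (suc i))
  ≡⟨ concatMap-cong (λ x → trans (map-concatMap (x ∷_) extend (tails (suc i) L))
                                  (concatMap-cong (λ f → sym (map-∘ values)) (tails (suc i) L)))
                    (upTo (suc i)) ⟩
    concatMap (λ x → concatMap (extend ∘ (x ∷_)) (tails (suc i) L)) (upTo (suc i))
  ≡⟨ concatMap-cong (λ x → sym (concatMap-map extend (x ∷_) (tails (suc i) L))) (upTo (suc i)) ⟩
    concatMap (λ x → concatMap extend (map (x ∷_) (tails (suc i) L))) (upTo (suc i))
  ≡⟨ MonadProperties.associative (upTo (suc i)) (λ x → map (x ∷_) (tails (suc i) L)) extend ⟩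
    concatMap extend (tails i (suc L))
  ≡⟨ cong (λ n → concatMap (λ f → map (λ x → f ++ (x ∷ [])) (upTo (suc n))) (tails i (suc L)))
          (sym (+-suc i L)) ⟩
    concatMap (λ f → map (λ x → f ++ (x ∷ [])) (upTo (suc (i + suc L)))) (tails i (suc L)) ∎
  where
  open ≡-Reasoning
  values : List ℕ
  values = upTo (suc (suc i + L))
  extend : List ℕ → List (List ℕ)
  extend f = map (λ x → f ++ (x ∷ [])) values

invSeqs-tails : ∀ n → invSeqs n ≡ tails 0 n
invSeqs-tails zero    = refl
invSeqs-tails (suc n) =
  trans (cong (concatMap (λ e → map (λ x → e ++ (x ∷ [])) (upTo (suc n)))) (invSeqs-tails n))
        (sym (tails-snoc n 0))

count-concatMap : ∀ p (f : ℕ → List (List ℕ)) (h : ℕ → ℕ) n →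
  count p (concatMap f (applyUpTo h n)) ≡ ∑ n (λ x → count p (f (h x)))
count-concatMap p f h zero    = refl
count-concatMap p f h (suc n) =
  trans (count-++ p (f (h 0)) _) (cong (count p (f (h 0)) +_) (count-concatMap p f (h ∘ suc) n))

count-tails-suc : ∀ p i L →
  count p (tails i (suc L)) ≡ ∑ (suc i) (λ x → count (p ∘ (x ∷_)) (tails (suc i) L))
count-tails-suc p i L =
  trans (count-concatMap p (λ x → map (x ∷_) (tails (suc i) L)) (λ x → x) (suc i))
        (∑-cong (suc i) (λ x _ → count-map p (x ∷_) (tails (suc i) L)))

<ᵇ-true : ∀ {m n} → m < n → (m <ᵇ n) ≡ true
<ᵇ-true {zero}  {suc n} _         = refl
<ᵇ-true {suc m} {suc n} (s≤s m<n) = <ᵇ-true m<n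

<ᵇ-false : ∀ {m n} → n ≤ m → (m <ᵇ n) ≡ false
<ᵇ-false {m}     {zero}  _         = refl
<ᵇ-false {suc m} {suc n} (s≤s n≤m) = <ᵇ-false n≤m

≤ᵇ-true : ∀ {m n} → m ≤ n → (m ≤ᵇ n) ≡ true
≤ᵇ-true {zero}  _   = refl
≤ᵇ-true {suc m} m≤n = <ᵇ-true m≤n

≤ᵇ-false : ∀ {m n} → n < m → (m ≤ᵇ n) ≡ false
≤ᵇ-false {suc m} (s≤s n≤m) = <ᵇ-false n≤m

∨-true : ∀ a {b} → b ≡ true → (a ∨ b) ≡ true
∨-true true  _ = refl
∨-true false p = p

nondec : ℕ → List ℕ → Bool
nondec m []          = true
nondec m (zero ∷ f)  = nondec m f
nondec m (suc x ∷ f) = (m ≤ᵇ suc x) ∧ nondec (suc x) f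

atLeast : ℕ → List ℕ → Bool
atLeast m []          = true
atLeast m (zero ∷ f)  = atLeast m f
atLeast m (suc x ∷ f) = (m ≤ᵇ suc x) ∧ atLeast m f

someBelow : ℕ → List ℕ → Bool
someBelow n f = any (λ z → (0 <ᵇ z) ∧ (z <ᵇ n)) f

atLeast-raise : ∀ {m} n f → m ≤ n → atLeast n f ≡ (atLeast m f ∧ not (someBelow n f))
atLeast-raise n []          _   = refl
atLeast-raise n (zero ∷ f)  m≤n = atLeast-raise n f m≤n
atLeast-raise {m} n (suc z ∷ f) m≤n with n ≤? suc z
... | yes n≤z rewrite ≤ᵇ-true n≤z | ≤ᵇ-true (≤-trans m≤n n≤z) | <ᵇ-false n≤z = atLeast-raise n f m≤n
... | no  n≰z rewrite ≤ᵇ-false (≰⇒> n≰z) | <ᵇ-true (≰⇒> n≰z) = sym (∧-zeroʳ _)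

someBelow-0 : ∀ f → someBelow 0 f ≡ false
someBelow-0 []      = refl
someBelow-0 (z ∷ f) = trans (cong (_∨ _) (∧-zeroʳ (0 <ᵇ z))) (someBelow-0 f)

nondec-has10Above : ∀ m f → nondec m f ≡ (atLeast m f ∧ not (has10Above 0 f))
nondec-has10Above m []          = refl
nondec-has10Above m (zero ∷ f)  rewrite someBelow-0 f = nondec-has10Above m f
nondec-has10Above m (suc x ∷ f) with m ≤? suc x
... | yes m≤x rewrite ≤ᵇ-true m≤x | nondec-has10Above (suc x) f | atLeast-raise (suc x) f m≤x =
  de-morgan (atLeast m f) (someBelow (suc x) f) (has10Above 0 f)
  where
  de-morgan : ∀ a b c → ((a ∧ not b) ∧ not c) ≡ (a ∧ not (b ∨ c))
  de-morgan true  true  c = refl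
  de-morgan true  false c = refl
  de-morgan false b     c = refl
... | no m≰x rewrite ≤ᵇ-false (≰⇒> m≰x) = refl

between-0 : ∀ x y f → any (λ z → (x <ᵇ z) ∧ (z <ᵇ y)) f ≡ true → any (λ z → (0 <ᵇ z) ∧ (z <ᵇ y)) f ≡ true
between-0 x y []      ()
between-0 x y (z ∷ f) p with x <ᵇ z in x<z | z <ᵇ y
... | true  | true  rewrite <ᵇ-true {0} {z} (≤-<-trans z≤n (<ᵇ⇒< x z (subst T (sym x<z) _))) = refl
... | true  | false = ∨-true _ (between-0 x y f p)
... | false | _     = ∨-true _ (between-0 x y f p)

has10Above-0 : ∀ x f → has10Above x f ≡ true → has10Above 0 f ≡ true
has10Above-0 x []      ()
has10Above-0 x (y ∷ f) p with any (λ z → (x <ᵇ z) ∧ (z <ᵇ y)) f in found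
... | true  rewrite between-0 x y f found = refl
... | false = ∨-true _ (has10Above-0 x f p)

contains021-has10Above : ∀ f → contains021 f ≡ true → has10Above 0 f ≡ true
contains021-has10Above []      ()
contains021-has10Above (x ∷ f) p with has10Above x f in found
... | true  = ∨-true _ (has10Above-0 x f found)
... | false = ∨-true _ (contains021-has10Above f p)

atLeast-1 : ∀ f → atLeast 1 f ≡ true
atLeast-1 []          = refl
atLeast-1 (zero ∷ f)  = atLeast-1 f
atLeast-1 (suc x ∷ f) = atLeast-1 f

-- An inversion sequence starting with 0 avoids 021 iff its positive entries
-- weakly increase: a 021 occurrence can always use the initial 0.
avoids021-nondec : ∀ f → avoids021 (0 ∷ f) ≡ nondec 1 f
avoids021-nondec f rewrite nondec-has10Above 1 f | atLeast-1 f with has10Above 0 f in found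
... | true  = refl
... | false with contains021 f in occurs
...   | true  with () ← trans (sym (contains021-has10Above f occurs)) found
...   | false = refl

-- Reading a continuation left to right, the
-- relevant data are: whether the previous entry was 0 (state Z) or equal to
-- the current largest entry m + 1 (state P), and the number D of admissible
-- values above m + 1.  The next entry is 0 (to state Z), m + 1 (to state P,
-- an ascent only from Z), or one of the D larger values (an ascent to P);
-- each step adds one admissible value at the top.
data State : Set where
  Z P : State

-- the step to the largest entry is an ascent from state Z only
floorStep : State → (ℕ → ℕ) → ℕ → ℕ
floorStep Z = shift
floorStep P f = f

-- paths L D s k: continuations of length L with exactly k ascents
paths : ℕ → ℕ → State → ℕ → ℕ
paths zero    D s zero    = 1
paths zero    D s (suc k) = 0
paths (suc L) D s k =
  paths L (suc D) Z k + floorStep s (paths L (suc D) P) k + ∑ D (λ c → shift (paths L (D ∸ c) P) k)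

shift-cong : ∀ {f g} → (∀ j → f j ≡ g j) → ∀ k → shift f k ≡ shift g k
shift-cong f≡g zero    = refl
shift-cong f≡g (suc k) = f≡g k

floorStep-cong : ∀ s {f g} → (∀ j → f j ≡ g j) → ∀ k → floorStep s f k ≡ floorStep s g k
floorStep-cong Z f≡g k = shift-cong f≡g k
floorStep-cong P f≡g k = f≡g k

paths-vanish : ∀ L D s k → L < k → paths L D s k ≡ 0
paths-vanish zero    D s (suc k) _         = refl
paths-vanish (suc L) D s (suc k) (s≤s L<k) =
  cong₂ _+_ (cong₂ _+_ (paths-vanish L (suc D) Z (suc k) (<⇒≤ (s≤s L<k))) (floorStep-vanish s))
            (∑-zero D (λ c → paths-vanish L (D ∸ c) P k L<k))
  where
  floorStep-vanish : ∀ s → floorStep s (paths L (suc D) P) (suc k) ≡ 0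
  floorStep-vanish Z = paths-vanish L (suc D) P k L<k
  floorStep-vanish P = paths-vanish L (suc D) P (suc k) (<⇒≤ (s≤s L<k))

-- the previous entry in state s when the largest entry so far is m + 1
-- (in state Z with no positive entry yet, m = 0 serves equally well)
lastEntry : State → ℕ → ℕ
lastEntry Z m = 0
lastEntry P m = suc m

admissible : State → ℕ → ℕ → List ℕ → Bool
admissible s m k f = nondec (suc m) f ∧ (ascentsFrom (lastEntry s m) f ≡ᵇ k)

tailCount : ℕ → ℕ → State → ℕ → ℕ → ℕ
tailCount i L s m k = count (admissible s m k) (tails i L)

count-ascent : ∀ (q : List ℕ → Bool) (asc : List ℕ → ℕ) k l →
  count (λ f → q f ∧ (suc (asc f) ≡ᵇ k)) l ≡ shift (λ j → count (λ f → q f ∧ (asc f ≡ᵇ j)) l) k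
count-ascent q asc zero    l = count-none (λ f → ∧-zeroʳ (q f)) l
count-ascent q asc (suc k) l = refl

count-below : ∀ s m k y l → y < m → count (admissible s m k ∘ (suc y ∷_)) l ≡ 0
count-below s m k y l y<m = count-none rejected l
  where
  rejected : ∀ f → admissible s m k (suc y ∷ f) ≡ false
  rejected f rewrite <ᵇ-false y<m = refl

count-floor : ∀ s m k l →
  count (admissible s m k ∘ (suc m ∷_)) l ≡ floorStep s (λ j → count (admissible P m j) l) k
count-floor Z m k l = trans (count-cong accepted l) (count-ascent (nondec (suc m)) (ascentsFrom (suc m)) k l)
  where
  accepted : ∀ f → admissible Z m k (suc m ∷ f) ≡ (nondec (suc m) f ∧ (suc (ascentsFrom (suc m) f) ≡ᵇ k))
  accepted f rewrite <ᵇ-true (n<1+n m) = refl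
count-floor P m k l = count-cong accepted l
  where
  accepted : ∀ f → admissible P m k (suc m ∷ f) ≡ admissible P m k f
  accepted f rewrite <ᵇ-true (n<1+n m) | <ᵇ-false {m} {m} ≤-refl = refl

count-jump : ∀ s m c k l →
  count (admissible s m k ∘ (suc (suc m + c) ∷_)) l ≡ shift (λ j → count (admissible P (suc m + c) j) l) k
count-jump s m c k l =
  trans (count-cong accepted l) (count-ascent (nondec (suc (suc m + c))) (ascentsFrom (suc (suc m + c))) k l)
  where
  x = suc (suc m + c)
  ascent : ∀ s → (lastEntry s m <ᵇ x) ≡ true
  ascent Z = refl
  ascent P = <ᵇ-true (s≤s (s≤s (m≤m+n m c)))
  accepted : ∀ f → admissible s m k (x ∷ f) ≡ (nondec x f ∧ (suc (ascentsFrom x f) ≡ᵇ k))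
  accepted f rewrite <ᵇ-true {m} {x} (s≤s (≤-trans (m≤m+n m c) (n≤1+n (m + c)))) | ascent s = refl

∑-entries : ∀ m D (g : ℕ → ℕ) →
  ∑ (suc (suc m + D)) g ≡ g 0 + (∑ m (g ∘ suc) + g (suc m)) + ∑ D (λ c → g (suc (suc m + c)))
∑-entries m D g = begin
    g 0 + ∑ (suc m + D) (g ∘ suc)
  ≡⟨ cong (g 0 +_) (∑-++ (suc m) D (g ∘ suc)) ⟩
    g 0 + (∑ (suc m) (g ∘ suc) + ∑ D (λ c → g (suc (suc m + c))))
  ≡⟨ cong (λ t → g 0 + (t + ∑ D (λ c → g (suc (suc m + c))))) (∑-last m (g ∘ suc)) ⟩
    g 0 + ((∑ m (g ∘ suc) + g (suc m)) + ∑ D (λ c → g (suc (suc m + c))))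
  ≡⟨ +-assoc (g 0) _ _ ⟨
    g 0 + (∑ m (g ∘ suc) + g (suc m)) + ∑ D (λ c → g (suc (suc m + c))) ∎
  where open ≡-Reasoning

tailCount-step : ∀ L D s m k → let i = suc (suc m + D) in
  tailCount (suc m + D) (suc L) s m k
  ≡ tailCount i L Z m k + floorStep s (tailCount i L P m) k + ∑ D (λ c → shift (tailCount i L P (suc m + c)) k)
tailCount-step L D s m k = begin
    count p (tails (suc m + D) (suc L))
  ≡⟨ count-tails-suc p (suc m + D) L ⟩
    ∑ (suc (suc m + D)) term
  ≡⟨ ∑-entries m D term ⟩
    term 0 + (∑ m (term ∘ suc) + term (suc m)) + ∑ D (λ c → term (suc (suc m + c)))
  ≡⟨ cong₂ (λ t u → term 0 + t + u)
       (cong₂ _+_ (trans (∑-cong m (λ y y<m → count-below s m k y (tails i L) y<m)) (∑-zero m (λ _ → refl)))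
                  (count-floor s m k (tails i L)))
       (∑-cong D (λ c _ → count-jump s m c k (tails i L))) ⟩
    tailCount i L Z m k + floorStep s (tailCount i L P m) k + ∑ D (λ c → shift (tailCount i L P (suc m + c)) k) ∎
  where
  open ≡-Reasoning
  i = suc (suc m + D)
  p = admissible s m k
  term : ℕ → ℕ
  term x = count (p ∘ (x ∷_)) (tails i L)

transfer : ∀ L D s m k → tailCount (suc m + D) L s m k ≡ paths L D s k
transfer zero    D s m zero    = refl
transfer zero    D s m (suc k) = refl
transfer (suc L) D s m k = trans (tailCount-step L D s m k)
  (cong₂ _+_ (cong₂ _+_ (stay Z m k) (floorStep-cong s (stay P m) k))
             (∑-cong D (λ c c<D → shift-cong (jump c (≤-pred (<⇒≤ (s≤s c<D)))) k)))
  where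
  stay : ∀ s m k → tailCount (suc (suc m + D)) L s m k ≡ paths L (suc D) s k
  stay s m k = trans (cong (λ i → tailCount i L s m k) (sym (+-suc (suc m) D))) (transfer L (suc D) s m k)
  jump : ∀ c → c ≤ D → ∀ j → tailCount (suc (suc m + D)) L P (suc m + c) j ≡ paths L (D ∸ c) P j
  jump c c≤D j = trans (cong (λ i → tailCount i L P (suc m + c) j) (cong (suc ∘ suc) index))
                       (transfer L (D ∸ c) P (suc m + c) j)
    where
    index : m + D ≡ m + c + (D ∸ c)
    index = trans (cong (m +_) (sym (m+[n∸m]≡n c≤D))) (sym (+-assoc m c (D ∸ c)))

-- Generating functions of the transfer recursion: x marks ascents and y the
-- remaining adjacent pairs, so the coefficient of xᵃ yᵇ has length a + b.
H : ℕ → State → Ser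
H D s a b = paths (a + b) D s a

-- the variable marking the step to the largest entry from state s
W : State → Ser
W Z = X
W P = Y

W-coefficient : State → Ser → ℕ → ℕ → ℕ
W-coefficient Z F a b = shift (λ i → F i b) a
W-coefficient P F a b = shift (F a) b

W-⊛ : ∀ s F a b → (W s ⊛ F) a b ≡ W-coefficient s F a b
W-⊛ Z = X-⊛
W-⊛ P = Y-⊛

agree-W : ∀ s {n F F′} → AgreeBelow n F F′ → AgreeBelow (suc n) (W s ⊛ F) (W s ⊛ F′)
agree-W Z = agree-X
agree-W P = agree-Y

too-many-ascents : ∀ a D s → paths (a + 0) D s (suc a) ≡ 0
too-many-ascents a D s = paths-vanish (a + 0) D s (suc a) (s≤s (≤-reflexive (+-identityʳ a)))

jumps : ℕ → ℕ → ℕ → ℕ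
jumps D L k = ∑ D (λ c → shift (paths L (D ∸ c) P) k)

H-unfold : ∀ D s a b →
  H D s a b ≡ 𝟙 a b + shift (H (suc D) Z a) b + W-coefficient s (H (suc D) P) a b
              + shift (λ i → ∑ D (λ c → H (D ∸ c) P i b)) a
H-unfold D Z zero    zero    = refl
H-unfold D P zero    zero    = refl
H-unfold D Z zero    (suc b) = cong (paths b (suc D) Z 0 + 0 +_) (∑-zero D (λ _ → refl))
H-unfold D P zero    (suc b) = cong (paths b (suc D) Z 0 + paths b (suc D) P 0 +_) (∑-zero D (λ _ → refl))
H-unfold D Z (suc a) zero    =
  cong (λ t → t + paths (a + 0) (suc D) P a + jumps D (a + 0) (suc a)) (too-many-ascents a (suc D) Z)
H-unfold D P (suc a) zero    =
  cong₂ (λ t u → t + u + jumps D (a + 0) (suc a)) (too-many-ascents a (suc D) Z) (too-many-ascents a (suc D) P)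
H-unfold D Z (suc a) (suc b) =
  cong (λ L → paths L (suc D) Z (suc a) + paths (a + suc b) (suc D) P a + jumps D (a + suc b) (suc a)) (+-suc a b)
H-unfold D P (suc a) (suc b) =
  cong (λ L → paths L (suc D) Z (suc a) + paths L (suc D) P (suc a) + jumps D (a + suc b) (suc a)) (+-suc a b)

H-rec : ∀ D s → H D s ≋ 𝟙 ⊕ Y ⊛ H (suc D) Z ⊕ W s ⊛ H (suc D) P ⊕ X ⊛ ∑S D (λ c → H (D ∸ c) P)
H-rec D s a b = trans (H-unfold D s a b) (sym (cong₂ _+_
  (cong₂ _+_ (cong (𝟙 a b +_) (Y-⊛ (H (suc D) Z) a b)) (W-⊛ s (H (suc D) P) a b))
  (trans (X-⊛ (∑S D (λ c → H (D ∸ c) P)) a b)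
         (shift-cong (λ i → ∑S-coefficient D (λ c → H (D ∸ c) P) i b) a))))

-- The recursion below, with constant term K = 1 + x H 1 P, is satisfied
-- both by H (D+1) s and by H D s · K; by uniqueness they coincide.  This
-- is the decomposition of a continuation at the first time the number of
-- admissible values above the maximum returns to its initial value.
K : Ser
K = 𝟙 ⊕ X ⊛ H 1 P

Recursion : (ℕ → State → Ser) → Set
Recursion Φ = ∀ D s → Φ D s ≋ K ⊕ Y ⊛ Φ (suc D) Z ⊕ W s ⊛ Φ (suc D) P ⊕ X ⊛ ∑S D (λ c → Φ (D ∸ c) P)

recursion-agree : ∀ {Φ Ψ} → Recursion Φ → Recursion Ψ → ∀ n D s → AgreeBelow n (Φ D s) (Ψ D s)
recursion-agree recΦ recΨ zero    D s = agree-zero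
recursion-agree recΦ recΨ (suc n) D s = agree-≋ (recΦ D s) (recΨ D s)
  (agree-⊕ (agree-⊕ (agree-⊕ agree-refl (agree-Y (recursion-agree recΦ recΨ n (suc D) Z)))
                    (agree-W s (recursion-agree recΦ recΨ n (suc D) P)))
           (agree-X (agree-∑S D (λ c → recursion-agree recΦ recΨ n (D ∸ c) P))))

module FirstReturn where
  open import Algebra.Solver.Ring.NaturalCoefficients.Default S₂.seriesSemiring
  open import Relation.Binary.Reasoning.Setoid BiSeries.setoid

  -- the last summand of the sum of H (D+1) splits off as x H 1 P
  shifted-recursion : Recursion (λ D s → H (suc D) s)
  shifted-recursion D s = begin
      H (suc D) s
    ≈⟨ H-rec (suc D) s ⟩
      𝟙 ⊕ Y ⊛ H (2 + D) Z ⊕ W s ⊛ H (2 + D) P ⊕ X ⊛ ∑S (suc D) J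
    ≈⟨ BiSeries.+-congˡ {𝟙 ⊕ Y ⊛ H (2 + D) Z ⊕ W s ⊛ H (2 + D) P} (BiSeries.*-congˡ {X}
         (BiSeries.trans (∑S-last D J) (BiSeries.+-cong (∑S-cong D lower) last))) ⟩
      𝟙 ⊕ Y ⊛ H (2 + D) Z ⊕ W s ⊛ H (2 + D) P ⊕ X ⊛ (∑S D (λ c → H (suc (D ∸ c)) P) ⊕ H 1 P)
    ≈⟨ regroup _ _ _ _ _ ⟩
      K ⊕ Y ⊛ H (2 + D) Z ⊕ W s ⊛ H (2 + D) P ⊕ X ⊛ ∑S D (λ c → H (suc (D ∸ c)) P) ∎
    where
    J : ℕ → Ser
    J c = H (suc D ∸ c) P
    lower : ∀ c → c < D → J c ≋ H (suc (D ∸ c)) P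
    lower c c<D a b = cong (λ E → H E P a b) (+-∸-assoc 1 (<⇒≤ c<D))
    last : J D ≋ H 1 P
    last a b = cong (λ E → H E P a b) (m+n∸n≡m 1 D)
    regroup : ∀ A B x S V → 𝟙 ⊕ A ⊕ B ⊕ x ⊛ (S ⊕ V) ≋ (𝟙 ⊕ x ⊛ V) ⊕ A ⊕ B ⊕ x ⊛ S
    regroup = solve 5 (λ A B x S V → con 1 :+ A :+ B :+ x :* (S :+ V) := (con 1 :+ x :* V) :+ A :+ B :+ x :* S)
                BiSeries.refl

  factored-recursion : Recursion (λ D s → H D s ⊛ K)
  factored-recursion D s = begin
      H D s ⊛ K
    ≈⟨ BiSeries.*-congʳ (H-rec D s) ⟩
      (𝟙 ⊕ Y ⊛ H (suc D) Z ⊕ W s ⊛ H (suc D) P ⊕ X ⊛ ∑S D (λ c → H (D ∸ c) P)) ⊛ K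
    ≈⟨ distribute _ _ _ _ _ _ _ ⟩
      K ⊕ Y ⊛ (H (suc D) Z ⊛ K) ⊕ W s ⊛ (H (suc D) P ⊛ K) ⊕ X ⊛ (∑S D (λ c → H (D ∸ c) P) ⊛ K)
    ≈⟨ BiSeries.+-congˡ {K ⊕ Y ⊛ (H (suc D) Z ⊛ K) ⊕ W s ⊛ (H (suc D) P ⊛ K)}
         (BiSeries.*-congˡ {X} (∑S-⊛ D (λ c → H (D ∸ c) P) K)) ⟩
      K ⊕ Y ⊛ (H (suc D) Z ⊛ K) ⊕ W s ⊛ (H (suc D) P ⊛ K) ⊕ X ⊛ ∑S D (λ c → H (D ∸ c) P ⊛ K) ∎
    where
    distribute : ∀ y w x A B S k → (𝟙 ⊕ y ⊛ A ⊕ w ⊛ B ⊕ x ⊛ S) ⊛ k ≋ k ⊕ y ⊛ (A ⊛ k) ⊕ w ⊛ (B ⊛ k) ⊕ x ⊛ (S ⊛ k)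
    distribute = solve 7 (λ y w x A B S k →
      (con 1 :+ y :* A :+ w :* B :+ x :* S) :* k := k :+ y :* (A :* k) :+ w :* (B :* k) :+ x :* (S :* k))
      BiSeries.refl

  first-return : ∀ D s → H (suc D) s ≋ H D s ⊛ K
  first-return D s = agree-everywhere (λ n → recursion-agree shifted-recursion factored-recursion n D s)

  -- from D = 0 no larger value can be reached
  H-zero : ∀ s → H 0 s ≋ 𝟙 ⊕ Y ⊛ H 1 Z ⊕ W s ⊛ H 1 P
  H-zero s = BiSeries.trans (H-rec 0 s)
    (BiSeries.trans (BiSeries.+-congˡ {𝟙 ⊕ Y ⊛ H 1 Z ⊕ W s ⊛ H 1 P} (BiSeries.zeroʳ X)) (BiSeries.+-identityʳ _))

  system : SymmetricSystem.System (H 1 Z) (H 1 P)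
  system = BiSeries.trans (first-return 0 Z) (BiSeries.*-congʳ (H-zero Z))
         , BiSeries.trans (first-return 0 P) (BiSeries.*-congʳ (H-zero P))

H₀-symmetric : ι (H 0 Z) ≋ H 0 Z
H₀-symmetric = begin
    ι (H 0 Z)
  ≈⟨ ι-cong (H-zero Z) ⟩
    ι (𝟙 ⊕ Y ⊛ U ⊕ X ⊛ V)
  ≈⟨ ι-⊕-cong (ι-⊕-cong ι-𝟙 (ι-⊛-cong ι-Y (ι-cong U≋ιV))) (ι-⊛-cong ι-X (BiSeries.sym U≋ιV)) ⟩
    𝟙 ⊕ X ⊛ V ⊕ Y ⊛ U
  ≈⟨ BiSeries.+-assoc 𝟙 (X ⊛ V) (Y ⊛ U) ⟩
    𝟙 ⊕ (X ⊛ V ⊕ Y ⊛ U)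
  ≈⟨ BiSeries.+-congˡ {𝟙} (BiSeries.+-comm (X ⊛ V) (Y ⊛ U)) ⟩
    𝟙 ⊕ (Y ⊛ U ⊕ X ⊛ V)
  ≈⟨ BiSeries.+-assoc 𝟙 (Y ⊛ U) (X ⊛ V) ⟨
    𝟙 ⊕ Y ⊛ U ⊕ X ⊛ V
  ≈⟨ H-zero Z ⟨
    H 0 Z ∎
  where
  open FirstReturn using (H-zero; system)
  open SymmetricSystem using (symmetric; ι-cong; ι-⊕-cong; ι-⊛-cong)
  open import Relation.Binary.Reasoning.Setoid BiSeries.setoid
  U = H 1 Z
  V = H 1 P
  U≋ιV : U ≋ ι V
  U≋ιV = symmetric system

-- a (n + 1) k counts the continuations after the forced first entry 0
a-paths : ∀ n k → a (suc n) k ≡ paths n 0 Z k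
a-paths n k = begin
    length (filter (λ e → p e ≟ true) (invSeqs (suc n)))
  ≡⟨ count-filter p (invSeqs (suc n)) ⟩
    count p (invSeqs (suc n))
  ≡⟨ cong (count p) (invSeqs-tails (suc n)) ⟩
    count p (tails 0 (suc n))
  ≡⟨ count-tails-suc p 0 n ⟩
    count (p ∘ (0 ∷_)) (tails 1 n) + 0
  ≡⟨ +-identityʳ _ ⟩
    count (p ∘ (0 ∷_)) (tails 1 n)
  ≡⟨ count-cong (λ f → cong (_∧ (ascentsFrom 0 f ≡ᵇ k)) (avoids021-nondec f)) (tails 1 n) ⟩
    tailCount 1 n Z 0 k
  ≡⟨ transfer n 0 Z 0 k ⟩
    paths n 0 Z k ∎
  where
  open ≡-Reasoning
  p : List ℕ → Bool
  p e = avoids021 e ∧ (ascents e ≡ᵇ k)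

a-coefficient : ∀ n k → k ≤ n → a (suc n) k ≡ H 0 Z k (n ∸ k)
a-coefficient n k k≤n = trans (a-paths n k) (cong (λ L → paths L 0 Z k) (sym (m+[n∸m]≡n k≤n)))

corollary4 : (n k : ℕ) → 1 ≤ n → k ≤ n ∸ 1 → a n k ≡ a n (n ∸ k ∸ 1)
corollary4 zero    k ()
corollary4 (suc n) k _ k≤n = begin
    a (suc n) k
  ≡⟨ a-coefficient n k k≤n ⟩
    H 0 Z k (n ∸ k)
  ≡⟨ H₀-symmetric (n ∸ k) k ⟩
    H 0 Z (n ∸ k) k
  ≡⟨ cong (H 0 Z (n ∸ k)) (m∸[m∸n]≡n k≤n) ⟨
    H 0 Z (n ∸ k) (n ∸ (n ∸ k))
  ≡⟨ a-coefficient n (n ∸ k) (m∸n≤m n k) ⟨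
    a (suc n) (n ∸ k)
  ≡⟨ cong (λ j → a (suc n) (j ∸ 1)) (+-∸-assoc 1 k≤n) ⟨
    a (suc n) (suc n ∸ k ∸ 1) ∎
  where open ≡-Reasoning
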